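{- Let $\mathfrak{g}$ be a Lie algebra, $(\rho,V)$ a representation of $\mathfrak{g}$, and $\psi:\mathfrak{g}\to V$ a linear kernel vector for $(\rho,V)$. Then for all $x,y\in\mathfrak{g}$, $$\rho(x)\big(\psi([x,y])-\rho(x)\psi(y)\big)=0\quad\text{and}\quad \rho(y)\big(\psi([x,y])-\rho(x)\psi(y)\big)=0.$$ Consequently, $\psi([x,y])-\rho(x)\psi(y)$ is annihilated by $\rho(z)$ for every element $z$ of the Lie subalgebra of $\mathfrak{g}$ generated by $x$ and $y$.
   Context: A linear kernel vector of a representation $(\rho,V)$ of $\mathfrak{g}$ is a linear map $\psi:\mathfrak{g}\to V$, not identically zero, such that $\rho(x)\psi(x)=0$ for every $x\in\mathfrak{g}$. -}

module Defs where

open import Level using (Level; _⊔_; suc)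
open import Algebra.Bundles using (CommutativeRing)
open import Algebra.Module.Bundles using (Module)
open import Data.Product using (∃; Σ)
open import Relation.Nullary using (¬_)

record IsField {c ℓ : Level} (K : CommutativeRing c ℓ) : Set (c ⊔ ℓ) where
  open CommutativeRing K
  field
    nontrivial : ¬ (1# ≈ 0#)
    inverse    : ∀ x → ¬ (x ≈ 0#) → ∃ λ y → x * y ≈ 1#

record LieAlgebra {c ℓ : Level} (K : CommutativeRing c ℓ) (a ℓa : Level)
       : Set (c ⊔ ℓ ⊔ suc (a ⊔ ℓa)) where
  open CommutativeRing K renaming (Carrier to Scalar)
  field
    module' : Module K a ℓa
  open Module module' public
  field
    [_,_]       : Carrierᴹ → Carrierᴹ → Carrierᴹ
    bracket-cong : ∀ {x x′ y y′} → x ≈ᴹ x′ → y ≈ᴹ y′ → [ x , y ] ≈ᴹ [ x′ , y′ ]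
    bracket-+ˡ   : ∀ x y z → [ x +ᴹ y , z ] ≈ᴹ [ x , z ] +ᴹ [ y , z ]
    bracket-+ʳ   : ∀ x y z → [ x , y +ᴹ z ] ≈ᴹ [ x , y ] +ᴹ [ x , z ]
    bracket-*ˡ   : ∀ (k : Scalar) x y → [ k *ₗ x , y ] ≈ᴹ k *ₗ [ x , y ]
    bracket-*ʳ   : ∀ (k : Scalar) x y → [ x , k *ₗ y ] ≈ᴹ k *ₗ [ x , y ]
    alternating  : ∀ x → [ x , x ] ≈ᴹ 0ᴹ
    jacobi       : ∀ x y z →
                   ([ x , [ y , z ] ] +ᴹ [ y , [ z , x ] ]) +ᴹ [ z , [ x , y ] ] ≈ᴹ 0ᴹ

record Representation {c ℓ a ℓa : Level} {K : CommutativeRing c ℓ}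
       (𝔤 : LieAlgebra K a ℓa) (b ℓb : Level)
       : Set (c ⊔ ℓ ⊔ a ⊔ ℓa ⊔ suc (b ⊔ ℓb)) where
  open CommutativeRing K renaming (Carrier to Scalar)
  module G = LieAlgebra 𝔤
  field
    V : Module K b ℓb
  open Module V public
  field
    ρ      : G.Carrierᴹ → Carrierᴹ → Carrierᴹ
    ρ-cong : ∀ {x x′ v v′} → x G.≈ᴹ x′ → v ≈ᴹ v′ → ρ x v ≈ᴹ ρ x′ v′
    ρ-+ˡ   : ∀ x y v → ρ (x G.+ᴹ y) v ≈ᴹ ρ x v +ᴹ ρ y v
    ρ-*ˡ   : ∀ (k : Scalar) x v → ρ (k G.*ₗ x) v ≈ᴹ k *ₗ ρ x v
    ρ-+ʳ   : ∀ x u v → ρ x (u +ᴹ v) ≈ᴹ ρ x u +ᴹ ρ x v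
    ρ-*ʳ   : ∀ (k : Scalar) x v → ρ x (k *ₗ v) ≈ᴹ k *ₗ ρ x v
    ρ-bracket : ∀ x y v →
                ρ G.[ x , y ] v ≈ᴹ ρ x (ρ y v) +ᴹ (-ᴹ ρ y (ρ x v))

record IsLinear {c ℓ a ℓa b ℓb : Level} {K : CommutativeRing c ℓ}
       {𝔤 : LieAlgebra K a ℓa} (R : Representation 𝔤 b ℓb)
       (ψ : LieAlgebra.Carrierᴹ 𝔤 → Representation.Carrierᴹ R)
       : Set (c ⊔ a ⊔ ℓa ⊔ ℓb) where
  open CommutativeRing K renaming (Carrier to Scalar)
  open Representation R
  field
    ψ-cong : ∀ {x y} → x G.≈ᴹ y → ψ x ≈ᴹ ψ y
    ψ-+    : ∀ x y → ψ (x G.+ᴹ y) ≈ᴹ ψ x +ᴹ ψ y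
    ψ-*    : ∀ (k : Scalar) x → ψ (k G.*ₗ x) ≈ᴹ k *ₗ ψ x

record IsLinearKernelVector {c ℓ a ℓa b ℓb : Level} {K : CommutativeRing c ℓ}
       {𝔤 : LieAlgebra K a ℓa} (R : Representation 𝔤 b ℓb)
       (ψ : LieAlgebra.Carrierᴹ 𝔤 → Representation.Carrierᴹ R)
       : Set (c ⊔ a ⊔ ℓa ⊔ ℓb) where
  open Representation R
  field
    linear  : IsLinear R ψ
    nonzero : ∃ λ x → ¬ (ψ x ≈ᴹ 0ᴹ)
    kernel  : ∀ x → ρ x (ψ x) ≈ᴹ 0ᴹ

data InSubalgebraGen {c ℓ a ℓa : Level} {K : CommutativeRing c ℓ}
     (𝔤 : LieAlgebra K a ℓa) (x y : LieAlgebra.Carrierᴹ 𝔤)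
     : LieAlgebra.Carrierᴹ 𝔤 → Set (c ⊔ a ⊔ ℓa) where
  gen₁ : InSubalgebraGen 𝔤 x y x
  gen₂ : InSubalgebraGen 𝔤 x y y
  zer  : InSubalgebraGen 𝔤 x y (LieAlgebra.0ᴹ 𝔤)
  add  : ∀ {u v} → InSubalgebraGen 𝔤 x y u → InSubalgebraGen 𝔤 x y v →
         InSubalgebraGen 𝔤 x y (LieAlgebra._+ᴹ_ 𝔤 u v)
  smul : ∀ (k : CommutativeRing.Carrier K) {u} → InSubalgebraGen 𝔤 x y u →
         InSubalgebraGen 𝔤 x y (LieAlgebra._*ₗ_ 𝔤 k u)
  brk  : ∀ {u v} → InSubalgebraGen 𝔤 x y u → InSubalgebraGen 𝔤 x y v →
         InSubalgebraGen 𝔤 x y (LieAlgebra.[_,_] 𝔤 u v)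
  resp : ∀ {u v} → LieAlgebra._≈ᴹ_ 𝔤 u v → InSubalgebraGen 𝔤 x y u →
         InSubalgebraGen 𝔤 x y v

{-# OPTIONS --safe #-}
-- Polarising ρ(z)ψ(z) = 0 at z = u + v gives ρ(u)ψ(v) = −ρ(v)ψ(u).  Applied to
-- ψ([x,y]) and combined with ρ([x,y]) = [ρ(x),ρ(y)], this turns ρ(x)ψ([x,y]) into
-- ρ(x)ρ(x)ψ(y) and ρ(y)ψ([x,y]) into ρ(y)ρ(x)ψ(y), so both ρ(x) and ρ(y) kill
-- w = ψ([x,y]) − ρ(x)ψ(y).  The annihilator of a vector is a Lie subalgebra, hence
-- it contains the subalgebra generated by x and y.
module Submission where

open import Defs
open import Level using (Level)
open import Algebra.Bundles using (CommutativeRing)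
open import Data.Product using (_×_; _,_)
import Algebra.Properties.AbelianGroup as AbelianGroupProperties
import Relation.Binary.Reasoning.Setoid as SetoidReasoning

module RepresentationProperties
  {c ℓ a ℓa b ℓb : Level} {K : CommutativeRing c ℓ} {𝔤 : LieAlgebra K a ℓa}
  (R : Representation 𝔤 b ℓb) where

  open CommutativeRing K using (0#)
  open Representation R
  open AbelianGroupProperties +ᴹ-abelianGroup
  open SetoidReasoning ≈ᴹ-setoid

  ρ-0ʳ : ∀ x → ρ x 0ᴹ ≈ᴹ 0ᴹ
  ρ-0ʳ x = begin
    ρ x 0ᴹ          ≈⟨ ρ-cong G.≈ᴹ-refl (≈ᴹ-sym (*ₗ-zeroˡ 0ᴹ)) ⟩
    ρ x (0# *ₗ 0ᴹ)  ≈⟨ ρ-*ʳ 0# x 0ᴹ ⟩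
    0# *ₗ ρ x 0ᴹ    ≈⟨ *ₗ-zeroˡ (ρ x 0ᴹ) ⟩
    0ᴹ              ∎

  ρ-0ˡ : ∀ v → ρ G.0ᴹ v ≈ᴹ 0ᴹ
  ρ-0ˡ v = begin
    ρ G.0ᴹ v             ≈⟨ ρ-cong (G.≈ᴹ-sym (G.*ₗ-zeroˡ G.0ᴹ)) ≈ᴹ-refl ⟩
    ρ (0# G.*ₗ G.0ᴹ) v   ≈⟨ ρ-*ˡ 0# G.0ᴹ v ⟩
    0# *ₗ ρ G.0ᴹ v       ≈⟨ *ₗ-zeroˡ (ρ G.0ᴹ v) ⟩
    0ᴹ                   ∎

  ρ-‿ʳ : ∀ x v → ρ x (-ᴹ v) ≈ᴹ -ᴹ ρ x v
  ρ-‿ʳ x v = inverseˡ-unique (ρ x (-ᴹ v)) (ρ x v) (begin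
    ρ x (-ᴹ v) +ᴹ ρ x v  ≈⟨ ≈ᴹ-sym (ρ-+ʳ x (-ᴹ v) v) ⟩
    ρ x (-ᴹ v +ᴹ v)      ≈⟨ ρ-cong G.≈ᴹ-refl (-ᴹ‿inverseˡ v) ⟩
    ρ x 0ᴹ               ≈⟨ ρ-0ʳ x ⟩
    0ᴹ                   ∎)

  ρ-difference≈0 : ∀ {x u v} → ρ x u ≈ᴹ ρ x v → ρ x (u +ᴹ -ᴹ v) ≈ᴹ 0ᴹ
  ρ-difference≈0 {x} {u} {v} ρxu≈ρxv = begin
    ρ x (u +ᴹ -ᴹ v)         ≈⟨ ρ-+ʳ x u (-ᴹ v) ⟩
    ρ x u +ᴹ ρ x (-ᴹ v)     ≈⟨ +ᴹ-congˡ (ρ-‿ʳ x v) ⟩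
    ρ x u +ᴹ -ᴹ ρ x v       ≈⟨ x≈y⇒x∙y⁻¹≈ε ρxu≈ρxv ⟩
    0ᴹ                      ∎

  ρ-[,]-annihilates : ∀ {x y w} → ρ x w ≈ᴹ 0ᴹ → ρ y w ≈ᴹ 0ᴹ →
                      ρ G.[ x , y ] w ≈ᴹ 0ᴹ
  ρ-[,]-annihilates {x} {y} {w} ρxw≈0 ρyw≈0 = begin
    ρ G.[ x , y ] w               ≈⟨ ρ-bracket x y w ⟩
    ρ x (ρ y w) +ᴹ -ᴹ ρ y (ρ x w)
      ≈⟨ +ᴹ-cong (ρ-cong G.≈ᴹ-refl ρyw≈0) (-ᴹ‿cong (ρ-cong G.≈ᴹ-refl ρxw≈0)) ⟩
    ρ x 0ᴹ +ᴹ -ᴹ ρ y 0ᴹ            ≈⟨ +ᴹ-cong (ρ-0ʳ x) (-ᴹ‿cong (ρ-0ʳ y)) ⟩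
    0ᴹ +ᴹ -ᴹ 0ᴹ                    ≈⟨ -ᴹ‿inverseʳ 0ᴹ ⟩
    0ᴹ                             ∎

  subalgebraGen⊆annihilator : ∀ {x y w} → ρ x w ≈ᴹ 0ᴹ → ρ y w ≈ᴹ 0ᴹ →
                              ∀ {z} → InSubalgebraGen 𝔤 x y z → ρ z w ≈ᴹ 0ᴹ
  subalgebraGen⊆annihilator {x} {y} {w} ρxw≈0 ρyw≈0 = go
    where
    go : ∀ {z} → InSubalgebraGen 𝔤 x y z → ρ z w ≈ᴹ 0ᴹ
    go gen₁             = ρxw≈0
    go gen₂             = ρyw≈0
    go zer              = ρ-0ˡ w
    go (add {u} {v} pu pv) =
      ≈ᴹ-trans (ρ-+ˡ u v w) (≈ᴹ-trans (+ᴹ-cong (go pu) (go pv)) (+ᴹ-identityˡ 0ᴹ))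
    go (smul k {u} pu)  = ≈ᴹ-trans (ρ-*ˡ k u w) (≈ᴹ-trans (*ₗ-congˡ (go pu)) (*ₗ-zeroʳ k))
    go (brk pu pv)      = ρ-[,]-annihilates (go pu) (go pv)
    go (resp u≈v pu)    = ≈ᴹ-trans (ρ-cong (G.≈ᴹ-sym u≈v) ≈ᴹ-refl) (go pu)

module KernelVectorProperties
  {c ℓ a ℓa b ℓb : Level} {K : CommutativeRing c ℓ} {𝔤 : LieAlgebra K a ℓa}
  (R : Representation 𝔤 b ℓb)
  {ψ : LieAlgebra.Carrierᴹ 𝔤 → Representation.Carrierᴹ R}
  (kv : IsLinearKernelVector R ψ) where

  open Representation R
  open IsLinearKernelVector kv
  open IsLinear linear using (ψ-+)
  open RepresentationProperties R
  open AbelianGroupProperties +ᴹ-abelianGroup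
  open SetoidReasoning ≈ᴹ-setoid

  ρ-ψ-antisym : ∀ x y → ρ x (ψ y) ≈ᴹ -ᴹ ρ y (ψ x)
  ρ-ψ-antisym x y = inverseˡ-unique (ρ x (ψ y)) (ρ y (ψ x)) (begin
    ρ x (ψ y) +ᴹ ρ y (ψ x)
      ≈⟨ +ᴹ-cong (+ᴹ-identityˡ _) (+ᴹ-identityʳ _) ⟨
    (0ᴹ +ᴹ ρ x (ψ y)) +ᴹ (ρ y (ψ x) +ᴹ 0ᴹ)
      ≈⟨ +ᴹ-cong (+ᴹ-congʳ (kernel x)) (+ᴹ-congˡ (kernel y)) ⟨
    (ρ x (ψ x) +ᴹ ρ x (ψ y)) +ᴹ (ρ y (ψ x) +ᴹ ρ y (ψ y))
      ≈⟨ +ᴹ-cong (ρ-+ʳ x (ψ x) (ψ y)) (ρ-+ʳ y (ψ x) (ψ y)) ⟨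
    ρ x (ψ x +ᴹ ψ y) +ᴹ ρ y (ψ x +ᴹ ψ y)  ≈⟨ ρ-+ˡ x y _ ⟨
    ρ (x G.+ᴹ y) (ψ x +ᴹ ψ y)             ≈⟨ ρ-cong G.≈ᴹ-refl (ψ-+ x y) ⟨
    ρ (x G.+ᴹ y) (ψ (x G.+ᴹ y))           ≈⟨ kernel (x G.+ᴹ y) ⟩
    0ᴹ                                    ∎)

  ρˡ-ψ-[,] : ∀ x y → ρ x (ψ G.[ x , y ]) ≈ᴹ ρ x (ρ x (ψ y))
  ρˡ-ψ-[,] x y = begin
    ρ x (ψ G.[ x , y ])                       ≈⟨ ρ-ψ-antisym x G.[ x , y ] ⟩
    -ᴹ ρ G.[ x , y ] (ψ x)                    ≈⟨ -ᴹ‿cong (ρ-bracket x y (ψ x)) ⟩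
    -ᴹ (ρ x (ρ y (ψ x)) +ᴹ -ᴹ ρ y (ρ x (ψ x)))
      ≈⟨ -ᴹ‿cong (+ᴹ-congˡ (-ᴹ‿cong (ρ-cong G.≈ᴹ-refl (kernel x)))) ⟩
    -ᴹ (ρ x (ρ y (ψ x)) +ᴹ -ᴹ ρ y 0ᴹ)         ≈⟨ -ᴹ‿cong (+ᴹ-congˡ (-ᴹ‿cong (ρ-0ʳ y))) ⟩
    -ᴹ (ρ x (ρ y (ψ x)) +ᴹ -ᴹ 0ᴹ)             ≈⟨ -ᴹ‿cong (+ᴹ-congˡ ε⁻¹≈ε) ⟩
    -ᴹ (ρ x (ρ y (ψ x)) +ᴹ 0ᴹ)                ≈⟨ -ᴹ‿cong (+ᴹ-identityʳ _) ⟩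
    -ᴹ ρ x (ρ y (ψ x))                        ≈⟨ -ᴹ‿cong (ρ-cong G.≈ᴹ-refl (ρ-ψ-antisym y x)) ⟩
    -ᴹ ρ x (-ᴹ ρ x (ψ y))                     ≈⟨ -ᴹ‿cong (ρ-‿ʳ x _) ⟩
    -ᴹ -ᴹ ρ x (ρ x (ψ y))                     ≈⟨ ⁻¹-involutive _ ⟩
    ρ x (ρ x (ψ y))                           ∎

  ρʳ-ψ-[,] : ∀ x y → ρ y (ψ G.[ x , y ]) ≈ᴹ ρ y (ρ x (ψ y))
  ρʳ-ψ-[,] x y = begin
    ρ y (ψ G.[ x , y ])                        ≈⟨ ρ-ψ-antisym y G.[ x , y ] ⟩
    -ᴹ ρ G.[ x , y ] (ψ y)                     ≈⟨ -ᴹ‿cong (ρ-bracket x y (ψ y)) ⟩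
    -ᴹ (ρ x (ρ y (ψ y)) +ᴹ -ᴹ ρ y (ρ x (ψ y)))
      ≈⟨ -ᴹ‿cong (+ᴹ-congʳ (ρ-cong G.≈ᴹ-refl (kernel y))) ⟩
    -ᴹ (ρ x 0ᴹ +ᴹ -ᴹ ρ y (ρ x (ψ y)))          ≈⟨ -ᴹ‿cong (+ᴹ-congʳ (ρ-0ʳ x)) ⟩
    -ᴹ (0ᴹ +ᴹ -ᴹ ρ y (ρ x (ψ y)))              ≈⟨ -ᴹ‿cong (+ᴹ-identityˡ _) ⟩
    -ᴹ -ᴹ ρ y (ρ x (ψ y))                      ≈⟨ ⁻¹-involutive _ ⟩
    ρ y (ρ x (ψ y))                            ∎

proposition5p3 : ∀ {c ℓ a ℓa b ℓb : Level}
    (K : CommutativeRing c ℓ) → IsField K →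
    (𝔤 : LieAlgebra K a ℓa) (R : Representation 𝔤 b ℓb)
    (ψ : LieAlgebra.Carrierᴹ 𝔤 → Representation.Carrierᴹ R) →
    IsLinearKernelVector R ψ →
    ∀ x y →
      let open Representation R
          w = ψ (G.[ x , y ]) +ᴹ (-ᴹ ρ x (ψ y))
      in (ρ x w ≈ᴹ 0ᴹ) × (ρ y w ≈ᴹ 0ᴹ) ×
         (∀ z → InSubalgebraGen 𝔤 x y z → ρ z w ≈ᴹ 0ᴹ)
proposition5p3 K _ 𝔤 R ψ kv x y =
  ρx-kills-w , ρy-kills-w , λ _ → subalgebraGen⊆annihilator ρx-kills-w ρy-kills-w
  where
  open Representation R
  open RepresentationProperties R
  open KernelVectorProperties R kv

  w : Carrierᴹ
  w = ψ G.[ x , y ] +ᴹ -ᴹ ρ x (ψ y)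

  ρx-kills-w : ρ x w ≈ᴹ 0ᴹ
  ρx-kills-w = ρ-difference≈0 (ρˡ-ψ-[,] x y)

  ρy-kills-w : ρ y w ≈ᴹ 0ᴹ
  ρy-kills-w = ρ-difference≈0 (ρʳ-ψ-[,] x y)
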